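{- Let $m$ be a positive integer, let $a,d_1,d_2\in\mathbb{Z}/m\mathbb{Z}$ with $\gcd(d_1,m)=\gcd(d_2,m)$, and let $n$ be a positive integer with $n\equiv 0$ or $n\equiv -1 \pmod{m/\gcd(d_1,m)}$. Then the arithmetic triangle $\nabla=\mathrm{AT}(a,d_1,d_2,n)$ satisfies $\mu_\nabla(x+\gcd(d_2-d_1,m))=\mu_\nabla(x)$ for all $x\in\mathbb{Z}/m\mathbb{Z}$.
   Context: For $d\in\mathbb{Z}/m\mathbb{Z}$, $\gcd(d,m)$ denotes the gcd of $m$ and any integer representative of $d$. The arithmetic triangle $\mathrm{AT}(a,d_1,d_2,n)$ is the multiset (family) $(a+id_2+jd_1)_{(i,j)}$ indexed by pairs of non-negative integers with $i+j<n$, elements in $\mathbb{Z}/m\mathbb{Z}$. $\mu_\nabla$ denotes the multiplicity function of $\nabla$, giving for each $x\in\mathbb{Z}/m\mathbb{Z}$ the number of indices $(i,j)$ with entry $x$. -}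

module Defs where

open import Data.Nat using (ℕ; zero; suc; _+_; _*_; _∸_; NonZero; ≢-nonZero; ≢-nonZero⁻¹)
open import Data.Nat.DivMod using (_mod_; _/_)
open import Data.Nat.GCD using (gcd; gcd[m,n]≢0)
open import Data.Nat.Divisibility using (_∣_)
open import Data.Fin using (Fin; toℕ)
open import Data.Fin.Properties using (_≟_)
open import Data.List using (List; []; _∷_; map; concatMap; upTo; filter; length)
open import Data.Product using (_×_; _,_)
open import Data.Sum using (inj₂)

ZMod : ℕ → Set
ZMod m = Fin m

gcdZ : (m : ℕ) → ZMod m → ℕ
gcdZ m d = gcd (toℕ d) m

gcdZ-nonZero : (m : ℕ) .{{_ : NonZero m}} (d : ZMod m) → NonZero (gcdZ m d)
gcdZ-nonZero m d = ≢-nonZero (gcd[m,n]≢0 (toℕ d) m (inj₂ (≢-nonZero⁻¹ m)))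

periodZ : (m : ℕ) .{{_ : NonZero m}} → ZMod m → ℕ
periodZ m d = _/_ m (gcdZ m d) {{gcdZ-nonZero m d}}

_+ₘ_ : {m : ℕ} .{{_ : NonZero m}} → ZMod m → ZMod m → ZMod m
_+ₘ_ {m} x y = (toℕ x + toℕ y) mod m

_-ₘ_ : {m : ℕ} .{{_ : NonZero m}} → ZMod m → ZMod m → ZMod m
_-ₘ_ {m} x y = (toℕ x + (m ∸ toℕ y)) mod m

fromℕₘ : (m : ℕ) .{{_ : NonZero m}} → ℕ → ZMod m
fromℕₘ m k = k mod m

triIndices : ℕ → List (ℕ × ℕ)
triIndices n = concatMap (λ i → map (λ j → (i , j)) (upTo (n ∸ i))) (upTo n)

atEntry : {m : ℕ} .{{_ : NonZero m}} → (a d₁ d₂ : ZMod m) → ℕ × ℕ → ZMod m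
atEntry {m} a d₁ d₂ (i , j) = (toℕ a + i * toℕ d₂ + j * toℕ d₁) mod m

μAT : {m : ℕ} .{{_ : NonZero m}} → (a d₁ d₂ : ZMod m) → (n : ℕ) → ZMod m → ℕ
μAT a d₁ d₂ n x = length (filter (λ p → atEntry a d₁ d₂ p ≟ x) (triIndices n))

-- Removing the first column or the first row of the triangle of size n + 1 shows that
-- μ(w + d₂ - d₁) = μ(w) as soon as the progressions a + j d₁ and a + i d₂ (i, j ≤ n) have
-- the same multiplicities. Both have period p = m / g, where g = gcd(d₁, m) = gcd(d₂, m),
-- and over one period each takes every value of a + gℤ exactly once and no other value;
-- so they agree on every length ≡ 0 or 1 (mod p), in particular on n + 1. Finally, by
-- Bézout, invariance under translation by d₂ - d₁ gives invariance under translation by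
-- its gcd with m.
module Submission where

import Algebra.Properties.CommutativeSemigroup as CommutativeSemigroupProperties
open import Data.Bool using (Bool; true; false)
open import Data.Bool.Properties using (T-≡)
open import Data.Fin using (toℕ)
open import Data.Fin.Properties using (toℕ-fromℕ<; toℕ-injective; toℕ<n) renaming (_≟_ to _≟ᶠ_)
open import Data.List using (List; []; _∷_; _++_; map; concatMap; applyUpTo; upTo; filter; length)
open import Data.List.Properties using (filter-++; length-++; map-cong; map-applyUpTo)
open import Data.Nat
open import Data.Nat.Coprimality using (coprime-/gcd; coprime-divisor) renaming (sym to coprime-sym)
open import Data.Nat.DivMod
open import Data.Nat.Divisibility
open import Data.Nat.GCD
  using (gcd; gcd-GCD; gcd[m,n]∣m; gcd[m,n]∣n; gcd[m,n]≢0; n/gcd[m,n]≢0; module Bézout)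
open import Data.Nat.ListAction using (sum)
open import Data.Nat.Properties
open import Data.Nat.Tactic.RingSolver using (solve-∀)
open import Data.Product using (∃-syntax; _×_; _,_)
open import Data.Sum using (_⊎_; inj₁; inj₂)
open import Function using (_∘_; id; _⇔_; mk⇔; Equivalence)
open import Relation.Binary.PropositionalEquality
open import Relation.Nullary using (contradiction)
open import Relation.Nullary.Decidable using (does; dec-true; does-⇔)
open import Relation.Unary using (Pred; Decidable)
open import Defs

open CommutativeSemigroupProperties +-commutativeSemigroup using (interchange)
open ≡-Reasoning

m<n⇒n∣m⇒m≡0 : ∀ {m n} → m < n → n ∣ m → m ≡ 0
m<n⇒n∣m⇒m≡0 {zero}  _   _   = refl
m<n⇒n∣m⇒m≡0 {suc m} m<n n∣m = contradiction n∣m (>⇒∤ m<n)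

≤1-≡ : ∀ {a b} → a ≤ 1 → b ≤ 1 → (0 < a → 0 < b) → (0 < b → 0 < a) → a ≡ b
≤1-≡ z≤n       z≤n       _   _   = refl
≤1-≡ (s≤s z≤n) (s≤s z≤n) _   _   = refl
≤1-≡ z≤n       (s≤s z≤n) _   b⇒a = contradiction (b⇒a z<s) λ ()
≤1-≡ (s≤s z≤n) z≤n       a⇒b _   = contradiction (a⇒b z<s) λ ()

indicator : Bool → ℕ
indicator false = 0
indicator true  = 1

count : ℕ → (ℕ → Bool) → ℕ
count zero    f = 0
count (suc L) f = indicator (f 0) + count L (f ∘ suc)

Hit : ℕ → (ℕ → Bool) → Set
Hit L f = ∃[ j ] j < L × f j ≡ true

count-cong : ∀ L {f g : ℕ → Bool} → (∀ j → f j ≡ g j) → count L f ≡ count L g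
count-cong zero    f≗g = refl
count-cong (suc L) f≗g = cong₂ _+_ (cong indicator (f≗g 0)) (count-cong L (f≗g ∘ suc))

count-+ : ∀ L L′ (f : ℕ → Bool) → count (L + L′) f ≡ count L f + count L′ (λ j → f (L + j))
count-+ zero    L′ f = refl
count-+ (suc L) L′ f =
  trans (cong (indicator (f 0) +_) (count-+ L L′ (f ∘ suc))) (sym (+-assoc (indicator (f 0)) _ _))

count-periodic : ∀ {p} {f : ℕ → Bool} → (∀ j → f (p + j) ≡ f j) →
                 ∀ k r → count (k * p + r) f ≡ k * count p f + count r f
count-periodic         periodic zero    r = refl
count-periodic {p} {f} periodic (suc k) r = begin
  count (p + k * p + r) f                         ≡⟨ cong (λ L → count L f) (+-assoc p (k * p) r) ⟩
  count (p + (k * p + r)) f                       ≡⟨ count-+ p (k * p + r) f ⟩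
  count p f + count (k * p + r) (λ j → f (p + j)) ≡⟨ cong (count p f +_) (count-cong (k * p + r) periodic) ⟩
  count p f + count (k * p + r) f                 ≡⟨ cong (count p f +_) (count-periodic periodic k r) ⟩
  count p f + (k * count p f + count r f)         ≡⟨ +-assoc (count p f) _ _ ⟨
  count p f + k * count p f + count r f           ∎

hit⇒count>0 : ∀ {L} {f : ℕ → Bool} → Hit L f → 0 < count L f
hit⇒count>0 {suc L}     (zero , _ , f0) rewrite f0 = z<s
hit⇒count>0 {suc L} {f} (suc j , s<s j<L , fj) =
  <-≤-trans (hit⇒count>0 (j , j<L , fj)) (m≤n+m _ (indicator (f 0)))

count>0⇒hit : ∀ {L} {f : ℕ → Bool} → 0 < count L f → Hit L f
count>0⇒hit {suc L} {f} count>0 with f 0 in f0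
... | true  = 0 , z<s , f0
... | false with j , j<L , fj ← count>0⇒hit {L} {f ∘ suc} count>0 = suc j , s<s j<L , fj

count≤1 : ∀ L (f : ℕ → Bool) →
          (∀ {j j′} → j < L → j′ < L → f j ≡ true → f j′ ≡ true → j ≡ j′) → count L f ≤ 1
count≤1 zero    f unique = z≤n
count≤1 (suc L) f unique with f 0 in f0
... | false = count≤1 L (f ∘ suc) λ j<L j′<L fj fj′ →
  suc-injective (unique (s<s j<L) (s<s j′<L) fj fj′)
... | true  = s≤s (≮⇒≥ λ rest>0 →
  let j , j<L , fj = count>0⇒hit rest>0 in 0≢1+n (unique z<s (s<s j<L) f0 fj))

count≤1-≡ : ∀ {L L′} {f f′ : ℕ → Bool} → count L f ≤ 1 → count L′ f′ ≤ 1 →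
          (Hit L f → Hit L′ f′) → (Hit L′ f′ → Hit L f) → count L f ≡ count L′ f′
count≤1-≡ c≤1 c′≤1 to from =
  ≤1-≡ c≤1 c′≤1 (hit⇒count>0 ∘ to ∘ count>0⇒hit) (hit⇒count>0 ∘ from ∘ count>0⇒hit)

triCount : ℕ → (ℕ → ℕ → Bool) → ℕ
triCount zero    P = 0
triCount (suc n) P = count (suc n) (P 0) + triCount n (P ∘ suc)

triCount-cong : ∀ n {P Q : ℕ → ℕ → Bool} → (∀ i j → P i j ≡ Q i j) → triCount n P ≡ triCount n Q
triCount-cong zero    P≗Q = refl
triCount-cong (suc n) P≗Q = cong₂ _+_ (count-cong (suc n) (P≗Q 0)) (triCount-cong n (P≗Q ∘ suc))

triCount-sum : ∀ n P → triCount n P ≡ sum (applyUpTo (λ i → count (n ∸ i) (P i)) n)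
triCount-sum zero    P = refl
triCount-sum (suc n) P = cong (count (suc n) (P 0) +_) (triCount-sum n (P ∘ suc))

triCount-column : ∀ n P →
  triCount (suc n) P ≡ count (suc n) (λ i → P i 0) + triCount n (λ i j → P i (suc j))
triCount-column zero    P = refl
triCount-column (suc n) P = begin
  (indicator (P 0 0) + count (suc n) (λ j → P 0 (suc j))) + triCount (suc n) (P ∘ suc)
    ≡⟨ cong (indicator (P 0 0) + count (suc n) (λ j → P 0 (suc j)) +_) (triCount-column n (P ∘ suc)) ⟩
  (indicator (P 0 0) + count (suc n) (λ j → P 0 (suc j)))
    + (count (suc n) (λ i → P (suc i) 0) + triCount n (λ i j → P (suc i) (suc j)))
    ≡⟨ interchange (indicator (P 0 0)) _ _ _ ⟩
  (indicator (P 0 0) + count (suc n) (λ i → P (suc i) 0))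
    + (count (suc n) (λ j → P 0 (suc j)) + triCount n (λ i j → P (suc i) (suc j)))
    ∎

triCount-shift : ∀ n P → count (suc n) (P 0) ≡ count (suc n) (λ i → P i 0) →
                 triCount n (λ i j → P (suc i) j) ≡ triCount n (λ i j → P i (suc j))
triCount-shift n P row≡column = +-cancelˡ-≡ (count (suc n) (P 0)) _ _ (begin
  count (suc n) (P 0) + triCount n (λ i j → P (suc i) j)  ≡⟨ triCount-column n P ⟩
  count (suc n) (λ i → P i 0) + shifted                   ≡⟨ cong (_+ shifted) row≡column ⟨
  count (suc n) (P 0) + shifted                           ∎)
  where shifted = triCount n (λ i j → P i (suc j))

module _ {a p} {A : Set a} {P : Pred A p} (P? : Decidable P) where

  length-filter-applyUpTo : ∀ (h : ℕ → A) L →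
                            length (filter P? (applyUpTo h L)) ≡ count L (λ j → does (P? (h j)))
  length-filter-applyUpTo h zero = refl
  length-filter-applyUpTo h (suc L) with does (P? (h 0))
  ... | true  = cong suc (length-filter-applyUpTo (h ∘ suc) L)
  ... | false = length-filter-applyUpTo (h ∘ suc) L

  length-filter-concatMap : ∀ {b} {B : Set b} (F : B → List A) xs →
    length (filter P? (concatMap F xs)) ≡ sum (map (λ x → length (filter P? (F x))) xs)
  length-filter-concatMap F []       = refl
  length-filter-concatMap F (x ∷ xs) = begin
    length (filter P? (F x ++ concatMap F xs))
      ≡⟨ cong length (filter-++ P? (F x) (concatMap F xs)) ⟩
    length (filter P? (F x) ++ filter P? (concatMap F xs))
      ≡⟨ length-++ (filter P? (F x)) ⟩
    length (filter P? (F x)) + length (filter P? (concatMap F xs))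
      ≡⟨ cong (length (filter P? (F x)) +_) (length-filter-concatMap F xs) ⟩
    length (filter P? (F x)) + sum (map (λ x → length (filter P? (F x))) xs)
      ∎

length-filter-triIndices : ∀ {p} {P : Pred (ℕ × ℕ) p} (P? : Decidable P) n →
  length (filter P? (triIndices n)) ≡ triCount n (λ i j → does (P? (i , j)))
length-filter-triIndices P? n = begin
  length (filter P? (concatMap row (upTo n)))
    ≡⟨ length-filter-concatMap P? row (upTo n) ⟩
  sum (map (λ i → length (filter P? (row i))) (upTo n))
    ≡⟨ cong sum (map-cong rowCount (upTo n)) ⟩
  sum (map (λ i → count (n ∸ i) (λ j → does (P? (i , j)))) (upTo n))
    ≡⟨ cong sum (map-applyUpTo id _ n) ⟩
  sum (applyUpTo (λ i → count (n ∸ i) (λ j → does (P? (i , j)))) n)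
    ≡⟨ triCount-sum n _ ⟨
  triCount n (λ i j → does (P? (i , j)))
    ∎
  where
  row : ℕ → List (ℕ × ℕ)
  row i = map (i ,_) (upTo (n ∸ i))

  rowCount : ∀ i → length (filter P? (row i)) ≡ count (n ∸ i) (λ j → does (P? (i , j)))
  rowCount i = trans (cong (length ∘ filter P?) (map-applyUpTo id (i ,_) (n ∸ i)))
                     (length-filter-applyUpTo P? (i ,_) (n ∸ i))

module Modulo (m : ℕ) .{{_ : NonZero m}} where

  infix 4 _≈_ _≈ᵇ_

  _≈_ : ℕ → ℕ → Set
  x ≈ y = x % m ≡ y % m

  _≈ᵇ_ : ℕ → ℕ → Bool
  x ≈ᵇ y = does (x % m ≟ y % m)

  ≈ᵇ⇒≈ : ∀ {x y} → (x ≈ᵇ y) ≡ true → x ≈ y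
  ≈ᵇ⇒≈ {x} {y} x≈ᵇy = ≡ᵇ⇒≡ (x % m) (y % m) (Equivalence.from T-≡ x≈ᵇy)

  ≈⇒≈ᵇ : ∀ {x y} → x ≈ y → (x ≈ᵇ y) ≡ true
  ≈⇒≈ᵇ {x} {y} = dec-true (x % m ≟ y % m)

  %-≈ : ∀ x → x % m ≈ x
  %-≈ x = m%n%n≡m%n x m

  +*-≈ : ∀ x k → x + k * m ≈ x
  +*-≈ x k = [m+kn]%n≡m%n x k m

  +-cong-≈ : ∀ {a b c d} → a ≈ b → c ≈ d → a + c ≈ b + d
  +-cong-≈ {a} {b} {c} {d} a≈b c≈d = begin
    (a + c) % m             ≡⟨ %-distribˡ-+ a c m ⟩
    (a % m + c % m) % m     ≡⟨ cong₂ (λ u v → (u + v) % m) a≈b c≈d ⟩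
    (b % m + d % m) % m     ≡⟨ %-distribˡ-+ b d m ⟨
    (b + d) % m             ∎

  *-cong-≈ : ∀ {a b c d} → a ≈ b → c ≈ d → a * c ≈ b * d
  *-cong-≈ {a} {b} {c} {d} a≈b c≈d = begin
    (a * c) % m             ≡⟨ %-distribˡ-* a c m ⟩
    (a % m * (c % m)) % m   ≡⟨ cong₂ (λ u v → (u * v) % m) a≈b c≈d ⟩
    (b % m * (d % m)) % m   ≡⟨ %-distribˡ-* b d m ⟨
    (b * d) % m             ∎

  x+c+[m∸c%m]≈x : ∀ x c → x + c + (m ∸ c % m) ≈ x
  x+c+[m∸c%m]≈x x c = begin
    (x + c + (m ∸ c % m)) % m       ≡⟨ cong (_% m) (+-assoc x c _) ⟩
    (x + (c + (m ∸ c % m))) % m     ≡⟨ +-cong-≈ {x} refl (+-cong-≈ {c} (sym (%-≈ c)) refl) ⟩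
    (x + (c % m + (m ∸ c % m))) % m ≡⟨ cong (λ t → (x + t) % m) (m+[n∸m]≡n (m%n≤n c m)) ⟩
    (x + m) % m                     ≡⟨ [m+n]%n≡m%n x m ⟩
    x % m                           ∎

  +-cancelʳ-≈ : ∀ {a b} c → a + c ≈ b + c → a ≈ b
  +-cancelʳ-≈ {a} {b} c a+c≈b+c =
    trans (sym (x+c+[m∸c%m]≈x a c)) (trans (+-cong-≈ a+c≈b+c refl) (x+c+[m∸c%m]≈x b c))

  +-cancelˡ-≈ : ∀ c {a b} → c + a ≈ c + b → a ≈ b
  +-cancelˡ-≈ c {a} {b} c+a≈c+b =
    +-cancelʳ-≈ c (trans (cong (_% m) (+-comm a c)) (trans c+a≈c+b (cong (_% m) (+-comm c b))))

  ≈⇒∣∸ : ∀ {x y} → x ≈ y → m ∣ y ∸ x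
  ≈⇒∣∸ {x} {y} x≈y = divides (y / m ∸ x / m) (begin
    y ∸ x                                    ≡⟨ cong₂ _∸_ (m≡m%n+[m/n]*n y m) (m≡m%n+[m/n]*n x m) ⟩
    y % m + y / m * m ∸ (x % m + x / m * m)  ≡⟨ cong (λ t → y % m + y / m * m ∸ (t + x / m * m)) x≈y ⟩
    y % m + y / m * m ∸ (y % m + x / m * m)  ≡⟨ [m+n]∸[m+o]≡n∸o (y % m) _ _ ⟩
    y / m * m ∸ x / m * m                    ≡⟨ *-distribʳ-∸ m (y / m) (x / m) ⟨
    (y / m ∸ x / m) * m                      ∎)

  ≈ᵇ-cong : ∀ {u u′ v v′} → u ≈ u′ → v ≈ v′ → (u ≈ᵇ v) ≡ (u′ ≈ᵇ v′)
  ≈ᵇ-cong {u} {u′} {v} {v′} u≈u′ v≈v′ =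
    does-⇔ (mk⇔ (λ u≈v → trans (sym u≈u′) (trans u≈v v≈v′))
                (λ u′≈v′ → trans u≈u′ (trans u′≈v′ (sym v≈v′))))
           (u % m ≟ v % m) (u′ % m ≟ v′ % m)

  ≈ᵇ-+ʳ : ∀ u v c → (u ≈ᵇ v) ≡ (u + c ≈ᵇ v + c)
  ≈ᵇ-+ʳ u v c = does-⇔ (mk⇔ (λ u≈v → +-cong-≈ u≈v refl) (+-cancelʳ-≈ c))
                       (u % m ≟ v % m) ((u + c) % m ≟ (v + c) % m)

  bézout : ∀ D → ∃[ x ] x * D ≈ gcd D m
  bézout D with Bézout.identity (gcd-GCD D m)
  ... | Bézout.+- x y g+ym≡xD = x , trans (cong (_% m) (sym g+ym≡xD)) (+*-≈ (gcd D m) y)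
  -- Here gcd D m ≡ - x D, and - x ≡ x (m - 1).
  ... | Bézout.-+ x y g+xD≡ym = x * pred m , +-cancelʳ-≈ (x * D) (begin
    (x * pred m * D + x * D) % m   ≡⟨ cong (_% m) (trans (rearrange x _ D) (cong (x * D *_) (suc-pred m))) ⟩
    (x * D * m) % m                ≡⟨ +*-≈ 0 (x * D) ⟩
    0 % m                          ≡⟨ +*-≈ 0 y ⟨
    (y * m) % m                    ≡⟨ cong (_% m) g+xD≡ym ⟨
    (gcd D m + x * D) % m          ∎)
    where
    rearrange : ∀ x k D → x * k * D + x * D ≡ x * D * suc k
    rearrange = solve-∀

  +-invariant⇒+gcd-invariant : ∀ {a} {A : Set a} {F : ℕ → A} {E} →
    (∀ {u v} → u ≈ v → F u ≡ F v) → (∀ w → F (w + E) ≡ F w) → ∀ w → F (w + gcd E m) ≡ F w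
  +-invariant⇒+gcd-invariant {F = F} {E} F-cong F-+ w =
    let x , xE≈g = bézout E in trans (F-cong (+-cong-≈ {w} refl (sym xE≈g))) (F-+* x w)
    where
    F-+* : ∀ k w → F (w + k * E) ≡ F w
    F-+* zero    w = cong F (+-identityʳ w)
    F-+* (suc k) w = begin
      F (w + (E + k * E)) ≡⟨ cong (F ∘ (w +_)) (+-comm E (k * E)) ⟩
      F (w + (k * E + E)) ≡⟨ cong F (+-assoc w (k * E) E) ⟨
      F (w + k * E + E)   ≡⟨ F-+ (w + k * E) ⟩
      F (w + k * E)       ≡⟨ F-+* k w ⟩
      F w                 ∎

  apHit : (a D z : ℕ) → ℕ → Bool
  apHit a D z j = a + j * D ≈ᵇ z

  module Period (D : ℕ) where

    instance
      gcd≢0 : NonZero (gcd D m)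
      gcd≢0 = ≢-nonZero (gcd[m,n]≢0 D m (inj₂ (≢-nonZero⁻¹ m)))

    period : ℕ
    period = m / gcd D m

    instance
      period≢0 : NonZero period
      period≢0 = ≢-nonZero (n/gcd[m,n]≢0 D m)

    period*D≡ : period * D ≡ D / gcd D m * m
    period*D≡ = begin
      m / g * D             ≡⟨ cong (m / g *_) (m/n*n≡m (gcd[m,n]∣m D m)) ⟨
      m / g * (D / g * g)   ≡⟨ x∙yz≈y∙xz (m / g) (D / g) g ⟩
      D / g * (m / g * g)   ≡⟨ cong (D / g *_) (m/n*n≡m (gcd[m,n]∣n D m)) ⟩
      D / g * m             ∎
      where
      g = gcd D m
      open CommutativeSemigroupProperties *-commutativeSemigroup using (x∙yz≈y∙xz)

    +period*-≈ : ∀ k j → (k * period + j) * D ≈ j * D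
    +period*-≈ k j = trans (cong (_% m) (begin
      (k * period + j) * D       ≡⟨ *-distribʳ-+ D (k * period) j ⟩
      k * period * D + j * D     ≡⟨ +-comm (k * period * D) (j * D) ⟩
      j * D + k * period * D     ≡⟨ cong (j * D +_) (*-assoc k period D) ⟩
      j * D + k * (period * D)   ≡⟨ cong (λ t → j * D + k * t) period*D≡ ⟩
      j * D + k * (q * m)        ≡⟨ cong (j * D +_) (*-assoc k q m) ⟨
      j * D + k * q * m          ∎)) (+*-≈ (j * D) (k * q))
      where q = D / gcd D m

    *-%period-≈ : ∀ j → j * D ≈ j % period * D
    *-%period-≈ j = trans (cong (λ t → t * D % m) (trans (m≡m%n+[m/n]*n j period) (+-comm (j % period) _)))
                          (+period*-≈ (j / period) (j % period))

    m∣k*D⇒period∣k : ∀ k → m ∣ k * D → period ∣ k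
    m∣k*D⇒period∣k k m∣kD = coprime-divisor (coprime-sym (coprime-/gcd D m))
      (subst (period ∣_) (*-comm k (D / g)) (m∣n*o⇒m/n∣o (gcd[m,n]∣n D m) (subst (m ∣_) kD≡ m∣kD)))
      where
      g = gcd D m
      kD≡ : k * D ≡ k * (D / g) * g
      kD≡ = trans (cong (k *_) (sym (m/n*n≡m (gcd[m,n]∣m D m)))) (sym (*-assoc k (D / g) g))

    *-injective-<period : ∀ {j j′} → j < period → j′ < period → j * D ≈ j′ * D → j ≡ j′
    *-injective-<period j<p j′<p jD≈j′D =
      ≤-antisym (≤-from-≈ j<p (sym jD≈j′D)) (≤-from-≈ j′<p jD≈j′D)
      where
      ≤-from-≈ : ∀ {u v} → u < period → v * D ≈ u * D → u ≤ v
      ≤-from-≈ {u} {v} u<p vD≈uD = m∸n≡0⇒m≤n (m<n⇒n∣m⇒m≡0 (≤-<-trans (m∸n≤m u v) u<p)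
        (m∣k*D⇒period∣k (u ∸ v) (subst (m ∣_) (sym (*-distribʳ-∸ D u v)) (≈⇒∣∸ vD≈uD))))

    gcd∣⇒multiple-<period : ∀ {c} → gcd D m ∣ c → ∃[ j ] j < period × j * D ≈ c
    gcd∣⇒multiple-<period (divides k refl) =
      let x , xD≈g = bézout D in
      k * x % period , m%n<n (k * x) period , (begin
        k * x % period * D % m  ≡⟨ *-%period-≈ (k * x) ⟨
        k * x * D % m           ≡⟨ cong (_% m) (*-assoc k x D) ⟩
        k * (x * D) % m         ≡⟨ *-cong-≈ {k} refl xD≈g ⟩
        k * gcd D m % m         ∎)

    apHit-periodic : ∀ a z j → apHit a D z (period + j) ≡ apHit a D z j
    apHit-periodic a z j = ≈ᵇ-cong (+-cong-≈ {a} refl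
      (trans (cong (λ t → (t + j) * D % m) (sym (*-identityˡ period))) (+period*-≈ 1 j))) refl

    apCount-period≤1 : ∀ a z → count period (apHit a D z) ≤ 1
    apCount-period≤1 a z = count≤1 period (apHit a D z) λ j<p j′<p hit hit′ →
      *-injective-<period j<p j′<p (+-cancelˡ-≈ a (trans (≈ᵇ⇒≈ hit) (sym (≈ᵇ⇒≈ hit′))))

  open Period using (period; gcd∣⇒multiple-<period; apHit-periodic; apCount-period≤1)

  period-cong : ∀ {D D′} → gcd D m ≡ gcd D′ m → period D ≡ period D′
  period-cong {D} {D′} = /-congʳ {{Period.gcd≢0 D}} {{Period.gcd≢0 D′}}

  apHit-transfer : ∀ a {D D′} z {L} → gcd D′ m ∣ D →
                   Hit L (apHit a D z) → Hit (period D′) (apHit a D′ z)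
  apHit-transfer a {D} {D′} z g′∣D (j , _ , hit) =
    let j′ , j′<p′ , j′D′≈jD = gcd∣⇒multiple-<period D′ (∣n⇒∣m*n j g′∣D) in
    j′ , j′<p′ , ≈⇒≈ᵇ (trans (+-cong-≈ {a} refl j′D′≈jD) (≈ᵇ⇒≈ hit))

  apCount-period-≡ : ∀ a {D D′} z → gcd D m ≡ gcd D′ m →
                     count (period D) (apHit a D z) ≡ count (period D′) (apHit a D′ z)
  apCount-period-≡ a {D} {D′} z g≡g′ = count≤1-≡ (apCount-period≤1 D a z) (apCount-period≤1 D′ a z)
    (apHit-transfer a z (subst (_∣ D) g≡g′ (gcd[m,n]∣m D m)))
    (apHit-transfer a z (subst (_∣ D′) (sym g≡g′) (gcd[m,n]∣m D′ m)))

  apCount-*period+≤1-≡ : ∀ a {D D′} z k {r} → gcd D m ≡ gcd D′ m → r ≤ 1 →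
    count (k * period D + r) (apHit a D z) ≡ count (k * period D + r) (apHit a D′ z)
  apCount-*period+≤1-≡ a {D} {D′} z k {r} g≡g′ r≤1 = begin
    count (k * p + r) (apHit a D z)
      ≡⟨ count-periodic (apHit-periodic D a z) k r ⟩
    k * count p (apHit a D z) + count r (apHit a D z)
      ≡⟨ cong₂ (λ c c′ → k * c + c′) (apCount-period-≡ a {D} {D′} z g≡g′) (first-terms r≤1) ⟩
    k * count p′ (apHit a D′ z) + count r (apHit a D′ z)
      ≡⟨ count-periodic (apHit-periodic D′ a z) k r ⟨
    count (k * p′ + r) (apHit a D′ z)
      ≡⟨ cong (λ q → count (k * q + r) (apHit a D′ z)) (period-cong {D} {D′} g≡g′) ⟨
    count (k * p + r) (apHit a D′ z)
      ∎
    where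
    p = period D
    p′ = period D′
    first-terms : ∀ {r} → r ≤ 1 → count r (apHit a D z) ≡ count r (apHit a D′ z)
    first-terms z≤n       = refl
    first-terms (s≤s z≤n) = refl

  apCount-≡ : ∀ a {D D′} z n → gcd D m ≡ gcd D′ m → period D ∣ n ⊎ period D ∣ suc n →
              count (suc n) (apHit a D z) ≡ count (suc n) (apHit a D′ z)
  apCount-≡ a {D} {D′} z n g≡g′ (inj₁ (divides k refl)) =
    subst (λ L → count L (apHit a D z) ≡ count L (apHit a D′ z)) (+-comm (k * period D) 1)
          (apCount-*period+≤1-≡ a z k g≡g′ (s≤s z≤n))
  apCount-≡ a {D} {D′} z n g≡g′ (inj₂ (divides k 1+n≡kp)) =
    subst (λ L → count L (apHit a D z) ≡ count L (apHit a D′ z))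
          (sym (trans 1+n≡kp (sym (+-identityʳ _))))
          (apCount-*period+≤1-≡ a z k g≡g′ z≤n)

  multiplicity : (a D₁ D₂ n w : ℕ) → ℕ
  multiplicity a D₁ D₂ n w = triCount n (λ i j → a + i * D₂ + j * D₁ ≈ᵇ w)

  multiplicity-cong : ∀ a D₁ D₂ n {w w′} → w ≈ w′ →
                      multiplicity a D₁ D₂ n w ≡ multiplicity a D₁ D₂ n w′
  multiplicity-cong a D₁ D₂ n w≈w′ = triCount-cong n λ i j → ≈ᵇ-cong refl w≈w′

  -- Both sides count the entries of the triangle of size n + 1 congruent to w + D₂,
  -- one without its first column and the other without its first row.
  multiplicity-+ : ∀ a {D₁ D₂ E} n → E + D₁ ≈ D₂ → gcd D₁ m ≡ gcd D₂ m →
                   period D₁ ∣ n ⊎ period D₁ ∣ suc n →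
                   ∀ w → multiplicity a D₁ D₂ n (w + E) ≡ multiplicity a D₁ D₂ n w
  multiplicity-+ a {D₁} {D₂} {E} n E+D₁≈D₂ g₁≡g₂ period∣ w = begin
    multiplicity a D₁ D₂ n (w + E)    ≡⟨ triCount-cong n column-step ⟩
    triCount n (λ i j → P i (suc j))  ≡⟨ triCount-shift n P row≡column ⟨
    triCount n (λ i j → P (suc i) j)  ≡⟨ triCount-cong n row-step ⟨
    multiplicity a D₁ D₂ n w          ∎
    where
    P : ℕ → ℕ → Bool
    P i j = a + i * D₂ + j * D₁ ≈ᵇ w + D₂

    column-step : ∀ i j → (a + i * D₂ + j * D₁ ≈ᵇ w + E) ≡ P i (suc j)
    column-step i j = trans (≈ᵇ-+ʳ _ _ D₁) (≈ᵇ-cong (cong (_% m) (next-column a i j D₁ D₂))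
      (trans (cong (_% m) (+-assoc w E D₁)) (+-cong-≈ {w} refl E+D₁≈D₂)))
      where
      next-column : ∀ a i j D₁ D₂ → a + i * D₂ + j * D₁ + D₁ ≡ a + i * D₂ + suc j * D₁
      next-column = solve-∀

    row-step : ∀ i j → (a + i * D₂ + j * D₁ ≈ᵇ w) ≡ P (suc i) j
    row-step i j = trans (≈ᵇ-+ʳ _ _ D₂) (cong (_≈ᵇ w + D₂) (next-row a i j D₁ D₂))
      where
      next-row : ∀ a i j D₁ D₂ → a + i * D₂ + j * D₁ + D₂ ≡ a + suc i * D₂ + j * D₁
      next-row = solve-∀

    row≡column : count (suc n) (P 0) ≡ count (suc n) (λ i → P i 0)
    row≡column = begin
      count (suc n) (P 0)          ≡⟨ count-cong (suc n) (λ j → cong (λ t → t + j * D₁ ≈ᵇ z) (+-identityʳ a)) ⟩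
      count (suc n) (apHit a D₁ z) ≡⟨ apCount-≡ a z n g₁≡g₂ period∣ ⟩
      count (suc n) (apHit a D₂ z) ≡⟨ count-cong (suc n) (λ i → cong (_≈ᵇ z) (+-identityʳ (a + i * D₂))) ⟨
      count (suc n) (λ i → P i 0)  ∎
      where z = w + D₂

  toℕ-mod : ∀ u → toℕ (u mod m) ≡ u % m
  toℕ-mod u = toℕ-fromℕ< (m%n<n u m)

  toℕ-mod-≈ : ∀ u → toℕ (u mod m) ≈ u
  toℕ-mod-≈ u = trans (cong (_% m) (toℕ-mod u)) (%-≈ u)

  mod≡⇔≈ : ∀ u (x : ZMod m) → (u mod m ≡ x) ⇔ u ≈ toℕ x
  mod≡⇔≈ u x = mk⇔
    (λ u-mod≡x → trans (sym (toℕ-mod u)) (trans (cong toℕ u-mod≡x) (sym x%m≡x)))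
    (λ u≈x → toℕ-injective (trans (toℕ-mod u) (trans u≈x x%m≡x)))
    where
    x%m≡x : toℕ x % m ≡ toℕ x
    x%m≡x = m<n⇒m%n≡m (toℕ<n x)

  toℕ-+ₘ-fromℕₘ : ∀ (x : ZMod m) k → toℕ (x +ₘ fromℕₘ m k) ≈ toℕ x + k
  toℕ-+ₘ-fromℕₘ x k = begin
    toℕ ((toℕ x + toℕ (k mod m)) mod m) % m ≡⟨ cong (_% m) (toℕ-mod _) ⟩
    (toℕ x + toℕ (k mod m)) % m % m         ≡⟨ %-≈ _ ⟩
    (toℕ x + toℕ (k mod m)) % m             ≡⟨ +-cong-≈ {toℕ x} refl (toℕ-mod-≈ k) ⟩
    (toℕ x + k) % m                         ∎

  toℕ[x-ₘy]+y≈x : ∀ (x y : ZMod m) → toℕ (x -ₘ y) + toℕ y ≈ toℕ x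
  toℕ[x-ₘy]+y≈x x y = begin
    (toℕ (x -ₘ y) + toℕ y) % m        ≡⟨ +-cong-≈ (toℕ-mod-≈ (toℕ x + (m ∸ toℕ y))) refl ⟩
    (toℕ x + (m ∸ toℕ y) + toℕ y) % m ≡⟨ cong (_% m) (+-assoc (toℕ x) _ _) ⟩
    (toℕ x + (m ∸ toℕ y + toℕ y)) % m ≡⟨ cong (λ t → (toℕ x + t) % m) (m∸n+n≡m (<⇒≤ (toℕ<n y))) ⟩
    (toℕ x + m) % m                   ≡⟨ [m+n]%n≡m%n (toℕ x) m ⟩
    toℕ x % m                         ∎

  μAT≡multiplicity : ∀ (a d₁ d₂ : ZMod m) n x →
                     μAT a d₁ d₂ n x ≡ multiplicity (toℕ a) (toℕ d₁) (toℕ d₂) n (toℕ x)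
  μAT≡multiplicity a d₁ d₂ n x =
    trans (length-filter-triIndices (λ ij → atEntry a d₁ d₂ ij ≟ᶠ x) n)
          (triCount-cong n λ i j →
            does-⇔ (mod≡⇔≈ _ x) (atEntry a d₁ d₂ (i , j) ≟ᶠ x) (entry i j % m ≟ toℕ x % m))
    where
    entry : ℕ → ℕ → ℕ
    entry i j = toℕ a + i * toℕ d₂ + j * toℕ d₁

theorem13 : (m : ℕ) .{{_ : NonZero m}} (a d₁ d₂ : ZMod m) →
    gcdZ m d₁ ≡ gcdZ m d₂ →
    (n : ℕ) → n ≥ 1 →
    (periodZ m d₁ ∣ n ⊎ periodZ m d₁ ∣ suc n) →
    (x : ZMod m) →
    μAT a d₁ d₂ n (x +ₘ fromℕₘ m (gcdZ m (d₂ -ₘ d₁))) ≡ μAT a d₁ d₂ n x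
theorem13 m a d₁ d₂ g₁≡g₂ n _ period∣ x = begin
  μAT a d₁ d₂ n (x +ₘ fromℕₘ m g)  ≡⟨ μAT≡multiplicity a d₁ d₂ n _ ⟩
  μ (toℕ (x +ₘ fromℕₘ m g))        ≡⟨ multiplicity-cong _ _ _ n (toℕ-+ₘ-fromℕₘ x g) ⟩
  μ (toℕ x + g)                    ≡⟨ +-invariant⇒+gcd-invariant (multiplicity-cong _ _ _ n) μ-+ (toℕ x) ⟩
  μ (toℕ x)                        ≡⟨ μAT≡multiplicity a d₁ d₂ n x ⟨
  μAT a d₁ d₂ n x                  ∎
  where
  open Modulo m
  g = gcdZ m (d₂ -ₘ d₁)
  μ = multiplicity (toℕ a) (toℕ d₁) (toℕ d₂) n
  μ-+ : ∀ w → μ (w + toℕ (d₂ -ₘ d₁)) ≡ μ w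
  μ-+ = multiplicity-+ (toℕ a) n (toℕ[x-ₘy]+y≈x d₂ d₁) g₁≡g₂ period∣
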